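{- Let $1\le m\le n$ and $k\ge 3$ be integers. If $B$ is a blue path on $m$ vertices, then $\tilde{r}_B\big(C_k,\mathcal L^{(\le k)}_n\big)\le 2n-2m$.
   Context: Online Ramsey game: Builder and Painter play on the infinite complete graph $K_{\mathbb N}$. For a colored graph $H$ (each edge red or blue) and nonempty families $\mathcal G_1,\mathcal G_2$ of finite graphs, the game $\tilde R_H(\mathcal G_1,\mathcal G_2)$ starts with a copy of $H$ already drawn and colored on the board. In each round Builder selects a previously unselected edge and Painter colors it red or blue. The game ends as soon as the graph of all colored edges contains a red copy of a graph in $\mathcal G_1$ or a blue copy of a graph in $\mathcal G_2$. $\tilde{r}_H(\mathcal G_1,\mathcal G_2)$ is the minimum number of rounds within which Builder can guarantee the end, both playing optimally; a single graph stands for the one-element family. $C_k$ is the cycle on $k$ vertices. A line forest is a graph every component of which is a path; $\mathcal L^{(\le t)}_m$ denotes the family of all line forests on $m$ vertices with at most $t$ components. -}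

module Defs where

open import Data.Nat using (ℕ; zero; suc; _≤_)
open import Data.List using (List; []; _∷_; _++_; [_]; length; concat)
open import Data.List.Membership.Propositional using (_∈_)
open import Data.List.Relation.Unary.All using (All)
open import Data.List.Relation.Unary.Unique.Propositional using (Unique)
open import Data.Product using (Σ; ∃; _×_; _,_)
open import Data.Sum using (_⊎_)
open import Data.Unit using (⊤)
open import Relation.Binary.PropositionalEquality using (_≡_; _≢_)
open import Relation.Nullary using (¬_)

data Colour : Set where
  red blue : Colour

-- The board: the finite set of coloured edges of K_ℕ, as a list of
-- (endpoint, endpoint, colour) entries (edges are unordered).
Board : Set
Board = List (ℕ × ℕ × Colour)

EdgeCol : Board → Colour → ℕ → ℕ → Set
EdgeCol b c u v = ((u , v , c) ∈ b) ⊎ ((v , u , c) ∈ b)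

Selected : Board → ℕ → ℕ → Set
Selected b u v = ∃ λ c → EdgeCol b c u v

ConsecCol : Board → Colour → List ℕ → Set
ConsecCol b c [] = ⊤
ConsecCol b c (x ∷ []) = ⊤
ConsecCol b c (x ∷ y ∷ r) = EdgeCol b c x y × ConsecCol b c (y ∷ r)

RedCycle : ℕ → Board → Set
RedCycle k b = Σ ℕ λ x → Σ (List ℕ) λ rest →
  (length (x ∷ rest) ≡ k) × Unique (x ∷ rest) × ConsecCol b red (x ∷ rest ++ [ x ])

NonEmpty : List ℕ → Set
NonEmpty [] = Data.Empty.⊥ where import Data.Empty
NonEmpty (_ ∷ _) = ⊤

-- A blue copy of some line forest on n vertices with at most t components:
-- a list of vertex-disjoint blue paths (each given by its vertex sequence,
-- nonempty), with n vertices in total and at most t paths.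
BlueLineForest : ℕ → ℕ → Board → Set
BlueLineForest n t b = Σ (List (List ℕ)) λ ps →
  All NonEmpty ps × (length (concat ps) ≡ n) × (length ps ≤ t) ×
  Unique (concat ps) × All (ConsecCol b blue) ps

Ended : ℕ → ℕ → Board → Set
Ended k n b = RedCycle k b ⊎ BlueLineForest n k b

-- Builder can force the end of the game R̃(C_k, L^{(≤k)}_n) from board b
-- within N further rounds (against every Painter).
data Wins (k n : ℕ) : ℕ → Board → Set where
  done : ∀ {N b} → Ended k n b → Wins k n N b
  step : ∀ {N b} (u v : ℕ) → u ≢ v → ¬ Selected b u v →
         ((c : Colour) → Wins k n N ((u , v , c) ∷ b)) → Wins k n (suc N) b

bluePathBoard : List ℕ → Board
bluePathBoard [] = []
bluePathBoard (x ∷ []) = []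
bluePathBoard (x ∷ y ∷ r) = (x , y , blue) ∷ bluePathBoard (y ∷ r)

-- Builder keeps vertex-disjoint blue paths P₁, …, P_L (P₁ on top) whose first
-- vertices form a red path, and asks for the edge from the first vertex of P₁ to a
-- fresh vertex. Red pushes the fresh vertex as a new path P₁. Blue prolongs P₁, and
-- then the edge between the first vertices of P₁ and P₂ is asked: red restores the
-- red path, blue joins P₁ and P₂ into a single blue path. When L = k, P₁ is a single
-- vertex and its edge to the first vertex of P_k either closes a red C_k or moves it
-- onto P_k. With V vertices covered, 2(n − V) + L − 1 (one more while P₁ waits to be
-- reconnected) drops in every round and starts at 2(n − m); and the game ends with a
-- blue line forest as soon as the L paths and n − V isolated vertices are at most k
-- components.

{-# OPTIONS --safe #-}
module Submission where

open import Defs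
open import Data.Nat using (ℕ; zero; suc; _≤_; _<_; _*_; _∸_; _+_; z≤n; s≤s; _≤?_; _≟_)
open import Data.Nat.ListAction using (sum)
open import Data.Nat.Properties
open import Data.Nat.Tactic.RingSolver using (solve-∀)
open import Data.List using (List; []; _∷_; _++_; [_]; length; map; concat; upTo; initLast; _∷ʳ′_)
open import Data.List.Properties
  using (++-assoc; ++-identityʳ; length-++; length-map; map-++; concat-++; concat-map-[_]; length-upTo)
open import Data.List.Membership.Propositional using (_∈_)
import Data.List.Membership.DecPropositional as DecMembership
open import Data.List.Relation.Binary.Subset.Propositional using (_⊆_)
open import Data.List.Relation.Unary.Any using (here; there)
open import Data.List.Relation.Unary.All as All using (All; []; _∷_)
import Data.List.Relation.Unary.All.Properties as Allₚ
open import Data.List.Relation.Unary.Unique.Propositional using (Unique)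
open import Data.List.Relation.Unary.AllPairs as AllPairs using ([]; _∷_)
import Data.List.Relation.Unary.Unique.Propositional.Properties as Uniqueₚ
open import Data.List.Relation.Binary.Permutation.Propositional
  using (_↭_; prep; ↭-refl; ↭-sym; ↭-trans; ↭-reflexive; ↭⇒↭ₛ)
open import Data.List.Relation.Binary.Permutation.Propositional.Properties
  using (shift; ++-comm; ↭-length; ++⁺ʳ; All-resp-↭)
import Data.List.Relation.Binary.Permutation.Setoid.Properties as Permutationₛ
open import Data.Product using (_×_; _,_; proj₁; proj₂)
open import Data.Product.Properties using (≡-dec)
open import Data.Sum using (inj₁; inj₂)
open import Data.Unit using (⊤; tt)
open import Data.Empty using (⊥-elim)
open import Function using (id)
open import Relation.Nullary using (¬_; Dec; yes; no)
open import Relation.Nullary.Decidable using (_⊎-dec_)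
open import Relation.Binary.PropositionalEquality
  using (_≡_; _≢_; refl; sym; trans; cong; cong₂; subst; setoid; module ≡-Reasoning)

_≟ᶜ_ : (c d : Colour) → Dec (c ≡ d)
red ≟ᶜ red = yes refl
red ≟ᶜ blue = no λ ()
blue ≟ᶜ red = no λ ()
blue ≟ᶜ blue = yes refl

EdgeCol? : ∀ b c u v → Dec (EdgeCol b c u v)
EdgeCol? b c u v = ((u , v , c) ∈? b) ⊎-dec ((v , u , c) ∈? b)
  where open DecMembership (≡-dec _≟_ (≡-dec _≟_ _≟ᶜ_)) using (_∈?_)

BoardBelow : Board → ℕ → Set
BoardBelow b B = ∀ {u v c} → (u , v , c) ∈ b → u < B × v < B

BoardBelow-∷ : ∀ {b B u v c} → BoardBelow b B → u < B → v < B → BoardBelow ((u , v , c) ∷ b) B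
BoardBelow-∷ below u<B v<B (here refl) = u<B , v<B
BoardBelow-∷ below u<B v<B (there e) = below e

BoardBelow-suc : ∀ {b B} → BoardBelow b B → BoardBelow b (suc B)
BoardBelow-suc below e with below e
... | u<B , v<B = m<n⇒m<1+n u<B , m<n⇒m<1+n v<B

Wins-suc : ∀ {k n N b} → Wins k n N b → Wins k n (suc N) b
Wins-suc (done end) = done end
Wins-suc (step u v u≢v unselected next) = step u v u≢v unselected (λ c → Wins-suc (next c))

-- Builder asks for uv unless it is already coloured, which costs no round.
query : ∀ {k n N b B} u v → BoardBelow b B → u < B → v < B → u ≢ v →
  (∀ c {b′} → b ⊆ b′ → BoardBelow b′ B → EdgeCol b′ c u v → Wins k n N b′) →
  Wins k n (suc N) b
query {b = b} u v below u<B v<B u≢v next with EdgeCol? b red u v | EdgeCol? b blue u v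
... | yes e | _ = Wins-suc (next red id below e)
... | no _ | yes e = Wins-suc (next blue id below e)
... | no ¬red | no ¬blue =
  step u v u≢v unselected λ c → next c there (BoardBelow-∷ below u<B v<B) (inj₁ (here refl))
  where
  unselected : ¬ Selected b u v
  unselected (red , e) = ¬red e
  unselected (blue , e) = ¬blue e

EdgeCol-sym : ∀ {b c u v} → EdgeCol b c u v → EdgeCol b c v u
EdgeCol-sym (inj₁ e) = inj₂ e
EdgeCol-sym (inj₂ e) = inj₁ e

EdgeCol-mono : ∀ {b b′ c u v} → b ⊆ b′ → EdgeCol b c u v → EdgeCol b′ c u v
EdgeCol-mono b⊆b′ (inj₁ e) = inj₁ (b⊆b′ e)
EdgeCol-mono b⊆b′ (inj₂ e) = inj₂ (b⊆b′ e)

ConsecCol-mono : ∀ {b b′ c} → b ⊆ b′ → ∀ xs → ConsecCol b c xs → ConsecCol b′ c xs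
ConsecCol-mono b⊆b′ [] _ = tt
ConsecCol-mono b⊆b′ (x ∷ []) _ = tt
ConsecCol-mono b⊆b′ (x ∷ y ∷ xs) (e , es) = EdgeCol-mono b⊆b′ e , ConsecCol-mono b⊆b′ (y ∷ xs) es

ConsecCol-++⁻ˡ : ∀ {b c} xs {ys} → ConsecCol b c (xs ++ ys) → ConsecCol b c xs
ConsecCol-++⁻ˡ [] _ = tt
ConsecCol-++⁻ˡ (x ∷ []) _ = tt
ConsecCol-++⁻ˡ (x ∷ y ∷ xs) (e , es) = e , ConsecCol-++⁻ˡ (y ∷ xs) es

ConsecCol-∷ʳ : ∀ {b c} xs {y z} → ConsecCol b c (xs ++ [ y ]) → EdgeCol b c y z →
  ConsecCol b c ((xs ++ [ y ]) ++ [ z ])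
ConsecCol-∷ʳ [] _ e = e , tt
ConsecCol-∷ʳ (x ∷ []) (e′ , _) e = e′ , e , tt
ConsecCol-∷ʳ (x ∷ x′ ∷ xs) (e′ , es) e = e′ , ConsecCol-∷ʳ (x′ ∷ xs) es e

-- Paths given by their first vertex and the rest

Path : Set
Path = ℕ × List ℕ

path : Path → List ℕ
path (h , t) = h ∷ t

vertices : List Path → List ℕ
vertices ps = concat (map path ps)

heads : List Path → List ℕ
heads = map proj₁

BluePath : Board → Path → Set
BluePath b p = ConsecCol b blue (path p)

BluePaths-mono : ∀ {b b′} → b ⊆ b′ → ∀ {ps} → All (BluePath b) ps → All (BluePath b′) ps
BluePaths-mono b⊆b′ = All.map (λ {p} → ConsecCol-mono b⊆b′ (path p))

vertices-++ : ∀ ps qs → vertices (ps ++ qs) ≡ vertices ps ++ vertices qs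
vertices-++ ps qs = trans (cong concat (map-++ path ps qs)) (sym (concat-++ (map path ps) (map path qs)))

heads-∷ʳ : ∀ ps (q : Path) → heads (ps ++ [ q ]) ≡ heads ps ++ [ proj₁ q ]
heads-∷ʳ ps q = map-++ proj₁ ps [ q ]

Unique-++⁻ʳ : ∀ (xs : List ℕ) {ys} → Unique (xs ++ ys) → Unique ys
Unique-++⁻ʳ [] u = u
Unique-++⁻ʳ (x ∷ xs) (_ ∷ u) = Unique-++⁻ʳ xs u

All-heads : ∀ {P : ℕ → Set} ps → All P (vertices ps) → All P (heads ps)
All-heads [] _ = []
All-heads ((h , t) ∷ ps) (ph ∷ pts) = ph ∷ All-heads ps (Allₚ.++⁻ʳ t pts)

Unique-heads : ∀ ps → Unique (vertices ps) → Unique (heads ps)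
Unique-heads [] _ = []
Unique-heads ((h , t) ∷ ps) (h∉ ∷ u) =
  All-heads ps (Allₚ.++⁻ʳ t h∉) ∷ Unique-heads ps (Unique-++⁻ʳ t u)

reverseOnto : List ℕ → Path → Path
reverseOnto [] p = p
reverseOnto (x ∷ xs) (h , t) = reverseOnto xs (x , h ∷ t)

reverseOnto-↭ : ∀ xs h t → path (reverseOnto xs (h , t)) ↭ (h ∷ xs) ++ t
reverseOnto-↭ [] h t = ↭-refl
reverseOnto-↭ (x ∷ xs) h t = ↭-trans (reverseOnto-↭ xs x (h ∷ t)) (shift h (x ∷ xs) t)

reverseOnto-ConsecCol : ∀ {b c} xs h t → ConsecCol b c (h ∷ xs) → ConsecCol b c (h ∷ t) →
  ConsecCol b c (path (reverseOnto xs (h , t)))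
reverseOnto-ConsecCol [] h t _ es = es
reverseOnto-ConsecCol (x ∷ xs) h t (e , es′) es =
  reverseOnto-ConsecCol xs x (h ∷ t) es′ (EdgeCol-sym e , es)

-- X reversed, then the edge between the first vertices, then p.
joinAtHeads : Path → Path → Path
joinAtHeads (e , xs) (u , ts) = reverseOnto xs (e , u ∷ ts)

-- B bounds every vertex in use, so B is always fresh.
record Forest (ps : List Path) (b : Board) (B : ℕ) : Set where
  field
    paths-blue : All (BluePath b) ps
    distinct : Unique (vertices ps)
    vertices-below : All (_< B) (vertices ps)
    board-below : BoardBelow b B

Forest-heads : ∀ {ps b B} → Forest ps b B → Unique (heads ps) × All (_< B) (heads ps)
Forest-heads {ps} F = Unique-heads ps distinct , All-heads ps vertices-below
  where open Forest F

Forest-single : ∀ {b B} h t → BluePath b (h , t) → Unique (h ∷ t) → All (_< B) (h ∷ t) →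
  BoardBelow b B → Forest ((h , t) ∷ []) b B
Forest-single h t blue-ht u below board-below = record
  { paths-blue = blue-ht ∷ []
  ; distinct = subst Unique (sym (++-identityʳ (h ∷ t))) u
  ; vertices-below = subst (All _) (sym (++-identityʳ (h ∷ t))) below
  ; board-below = board-below }

Forest-reshape : ∀ {ps qs b b′ B} → Forest ps b B → vertices qs ↭ vertices ps →
  All (BluePath b′) qs → BoardBelow b′ B → Forest qs b′ B
Forest-reshape F qs↭ps blue-qs board-below = record
  { paths-blue = blue-qs
  ; distinct = Permutationₛ.Unique-resp-↭ (setoid ℕ) (↭⇒↭ₛ (↭-sym qs↭ps)) distinct
  ; vertices-below = All-resp-↭ (↭-sym qs↭ps) vertices-below
  ; board-below = board-below }
  where open Forest F hiding (board-below)

Forest-grow : ∀ {ps qs b b′ B} → Forest ps b B → vertices qs ≡ B ∷ vertices ps →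
  All (BluePath b′) qs → BoardBelow b′ (suc B) → Forest qs b′ (suc B)
Forest-grow {B = B} F qs≡ blue-qs board-below = record
  { paths-blue = blue-qs
  ; distinct = subst Unique (sym qs≡) (All.map >⇒≢ vertices-below ∷ distinct)
  ; vertices-below = subst (All (_< suc B)) (sym qs≡) (≤-refl ∷ All.map m<n⇒m<1+n vertices-below)
  ; board-below = board-below }
  where open Forest F hiding (board-below)

closing-↭ : ∀ u mid h t → vertices ((u , h ∷ t) ∷ mid) ↭ vertices ((u , []) ∷ mid ++ [ (h , t) ])
closing-↭ u mid h t = prep u (↭-trans (++-comm (h ∷ t) (vertices mid)) (↭-reflexive (sym
  (trans (vertices-++ mid [ (h , t) ]) (cong (vertices mid ++_) (++-identityʳ (h ∷ t)))))))

Forest-close : ∀ {u mid h t b b′ B} → Forest ((u , []) ∷ mid ++ [ (h , t) ]) b B →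
  b ⊆ b′ → BoardBelow b′ B → EdgeCol b′ blue u h → Forest ((u , h ∷ t) ∷ mid) b′ B
Forest-close {u} {mid} {h} {t} F b⊆b′ board-below e =
  Forest-reshape F (closing-↭ u mid h t) (blue-paths (All.tail (Forest.paths-blue F))) board-below
  where
  blue-paths : All (BluePath _) (mid ++ [ (h , t) ]) → All (BluePath _) ((u , h ∷ t) ∷ mid)
  blue-paths blue-rest with Allₚ.++⁻ mid blue-rest
  ... | blue-mid , blue-ht ∷ [] =
    (e , ConsecCol-mono b⊆b′ (h ∷ t) blue-ht) ∷ BluePaths-mono b⊆b′ blue-mid

joining-↭ : ∀ X p r → vertices (joinAtHeads X p ∷ r) ↭ vertices (X ∷ p ∷ r)
joining-↭ (e , xs) (u , ts) r = ↭-trans (++⁺ʳ (vertices r) (reverseOnto-↭ xs e (u ∷ ts)))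
  (↭-reflexive (++-assoc (e ∷ xs) (u ∷ ts) (vertices r)))

Forest-join : ∀ {X p r b b′ B} → Forest (X ∷ p ∷ r) b B →
  b ⊆ b′ → BoardBelow b′ B → EdgeCol b′ blue (proj₁ X) (proj₁ p) →
  Forest (joinAtHeads X p ∷ r) b′ B
Forest-join {e , xs} {u , ts} {r} F b⊆b′ board-below edge =
  Forest-reshape F (joining-↭ (e , xs) (u , ts) r) (joined-blue (Forest.paths-blue F)) board-below
  where
  joined-blue : All (BluePath _) ((e , xs) ∷ (u , ts) ∷ r) →
    All (BluePath _) (joinAtHeads (e , xs) (u , ts) ∷ r)
  joined-blue (blue-X ∷ blue-p ∷ blue-r) =
    reverseOnto-ConsecCol xs e (u ∷ ts) (ConsecCol-mono b⊆b′ (e ∷ xs) blue-X)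
      (edge , ConsecCol-mono b⊆b′ (u ∷ ts) blue-p)
    ∷ BluePaths-mono b⊆b′ blue-r

-- The L paths of a forest together with n − V fresh isolated vertices.
blueLineForest : ∀ {n k ps b B} → Forest ps b B → length (vertices ps) ≤ n →
  length ps + (n ∸ length (vertices ps)) ≤ k → BlueLineForest n k b
blueLineForest {n} {k} {ps} {b} {B} F V≤n fits =
  components , nonEmpty , size , count , unique , blue-components
  where
  open Forest F
  V = length (vertices ps)
  s = n ∸ V
  isolated = map (B +_) (upTo s)
  components = map path ps ++ map [_] isolated
  length-isolated : length isolated ≡ s
  length-isolated = trans (length-map (B +_) (upTo s)) (length-upTo s)
  concat-components : concat components ≡ vertices ps ++ isolated
  concat-components = trans (sym (concat-++ (map path ps) (map [_] isolated)))
    (cong (vertices ps ++_) (concat-map-[ isolated ]))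
  nonEmpty : All NonEmpty components
  nonEmpty = Allₚ.++⁺ (Allₚ.map⁺ (All.universal (λ _ → tt) ps))
    (Allₚ.map⁺ (All.universal (λ _ → tt) isolated))
  size : length (concat components) ≡ n
  size = begin
    length (concat components)        ≡⟨ cong length concat-components ⟩
    length (vertices ps ++ isolated)  ≡⟨ length-++ (vertices ps) ⟩
    V + length isolated               ≡⟨ cong (V +_) length-isolated ⟩
    V + (n ∸ V)                       ≡⟨ m+[n∸m]≡n V≤n ⟩
    n                                 ∎
    where open ≡-Reasoning
  count : length components ≤ k
  count = subst (_≤ k) (sym (trans (length-++ (map path ps))
    (cong₂ _+_ (length-map path ps) (trans (length-map [_] isolated) length-isolated)))) fits
  below-isolated : All (B ≤_) isolated
  below-isolated = Allₚ.map⁺ (All.universal (m≤m+n B) (upTo s))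
  unique : Unique (concat components)
  unique = subst Unique (sym concat-components) (Uniqueₚ.++⁺ distinct
    (Uniqueₚ.map⁺ (+-cancelˡ-≡ B _ _) (Uniqueₚ.upTo⁺ s))
    λ (v∈ps , v∈isolated) →
      <⇒≱ (All.lookup vertices-below v∈ps) (All.lookup below-isolated v∈isolated))
  blue-components : All (ConsecCol b blue) components
  blue-components = Allₚ.++⁺ (Allₚ.map⁺ paths-blue) (Allₚ.map⁺ (All.universal (λ _ → tt) isolated))

notAllCovered : ∀ {L V k n} → ¬ (L + (n ∸ V) ≤ k) → L ≤ k → V < n
notAllCovered {L} ¬fits L≤k = ≰⇒> λ n≤V →
  ¬fits (subst (_≤ _) (sym (trans (cong (L +_) (m≤n⇒m∸n≡0 n≤V)) (+-identityʳ L))) L≤k)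

bluePathBoard-blue : ∀ vs → ConsecCol (bluePathBoard vs) blue vs
bluePathBoard-blue [] = tt
bluePathBoard-blue (x ∷ []) = tt
bluePathBoard-blue (x ∷ y ∷ vs) =
  inj₁ (here refl) , ConsecCol-mono there (y ∷ vs) (bluePathBoard-blue (y ∷ vs))

bluePathBoard-below : ∀ {B} vs → All (_< B) vs → BoardBelow (bluePathBoard vs) B
bluePathBoard-below (x ∷ y ∷ vs) (x<B ∷ y<B ∷ _) (here refl) = x<B , y<B
bluePathBoard-below (x ∷ y ∷ vs) (_ ∷ below) (there e) = bluePathBoard-below (y ∷ vs) below e

All-<-suc-sum : ∀ vs → All (_< suc (sum vs)) vs
All-<-suc-sum [] = []
All-<-suc-sum (x ∷ vs) =
  s≤s (m≤m+n x (sum vs)) ∷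
  All.map (λ v<s → ≤-trans v<s (s≤s (m≤n+m (sum vs) x))) (All-<-suc-sum vs)

-- 2 (n − V) + w − 1 ≤ N, stated without truncated subtraction.
record Budget (n N w V : ℕ) : Set where
  constructor mkBudget
  field bound : 2 * n + w ≤ suc (N + 2 * V)

Budget-spend : ∀ {n N w V} → Budget n (suc N) (suc w) V → Budget n N w V
Budget-spend {n} {w = w} (mkBudget h) =
  mkBudget (≤-pred (≤-trans (≤-reflexive (sym (+-suc (2 * n) w))) h))

Budget-grow : ∀ {n N w V} → Budget n (suc N) w V → Budget n N (suc w) (suc V)
Budget-grow {n} {N} {w} {V} (mkBudget h) = mkBudget (begin
  2 * n + suc w              ≡⟨ +-suc (2 * n) w ⟩
  suc (2 * n + w)            ≤⟨ s≤s h ⟩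
  suc (suc (suc N + 2 * V))  ≡⟨ rearrange N V ⟩
  suc (N + 2 * suc V)        ∎)
  where
  open ≤-Reasoning
  rearrange : ∀ N V → suc (suc (suc N + 2 * V)) ≡ suc (N + 2 * suc V)
  rearrange = solve-∀

Budget-weaken : ∀ {n N w w′ V} → w′ ≤ w → Budget n N w V → Budget n N w′ V
Budget-weaken {n} w′≤w (mkBudget h) = mkBudget (≤-trans (+-monoʳ-≤ (2 * n) w′≤w) h)

Budget-exhausted : ∀ {n w V} → Budget n 0 (suc w) V → n ≤ V
Budget-exhausted {n} {w} (mkBudget h) =
  *-cancelˡ-≤ 2 (m+n≤o⇒m≤o (2 * n) (≤-pred (≤-trans (≤-reflexive (sym (+-suc (2 * n) w))) h)))

Budget-initial : ∀ {n m} → m ≤ n → Budget n (2 * n ∸ 2 * m) 1 m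
Budget-initial {n} m≤n = mkBudget
  (≤-reflexive (trans (+-comm (2 * n) 1) (cong suc (sym (m∸n+n≡m (*-monoʳ-≤ 2 m≤n))))))

module Strategy (k n : ℕ) (3≤k : 3 ≤ k) where

  1≢k : 1 ≢ k
  1≢k = <⇒≢ (≤-trans (s≤s (s≤s z≤n)) 3≤k)

  TopSingle : List Path → Set
  TopSingle [] = ⊤
  TopSingle ((_ , t) ∷ _) = t ≡ []

  -- st lists P₁, …, P_L; N is the number of rounds Builder may still use.
  record Config (N : ℕ) (st : List Path) (b : Board) (B : ℕ) : Set where
    field
      forest : Forest st b B
      red-heads : ConsecCol b red (heads st)
      few-paths : length st ≤ k
      full⇒top-single : length st ≡ k → TopSingle st
      few-vertices : length (vertices st) ≤ n
      budget : Budget n N (length st) (length (vertices st))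

  -- X has just been prolonged and its first vertex is not yet on the red path.
  record Detached (N : ℕ) (X : Path) (st : List Path) (b : Board) (B : ℕ) : Set where
    field
      forest : Forest (X ∷ st) b B
      red-heads : ConsecCol b red (heads st)
      few-paths : 2 + length st ≤ k
      few-vertices : length (vertices (X ∷ st)) ≤ n
      budget : Budget n N (2 + length st) (length (vertices (X ∷ st)))

  initialConfig : ∀ v vs → length (v ∷ vs) ≤ n → Unique (v ∷ vs) →
    Config (2 * n ∸ 2 * length (v ∷ vs)) ((v , vs) ∷ []) (bluePathBoard (v ∷ vs)) (suc (sum (v ∷ vs)))
  initialConfig v vs m≤n distinct = record
    { forest = Forest-single v vs (bluePathBoard-blue (v ∷ vs)) distinct below
        (bluePathBoard-below (v ∷ vs) below)
    ; red-heads = tt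
    ; few-paths = ≤-trans (s≤s z≤n) 3≤k
    ; full⇒top-single = λ full → ⊥-elim (1≢k full)
    ; few-vertices = subst (_≤ n) (sym V≡) m≤n
    ; budget = subst (Budget n _ 1) (sym V≡) (Budget-initial m≤n) }
    where
    below = All-<-suc-sum (v ∷ vs)
    V≡ : length (vertices ((v , vs) ∷ [])) ≡ length (v ∷ vs)
    V≡ = cong length (++-identityʳ (v ∷ vs))

  push : ∀ {N u ts r b b′ B} → Config (suc N) ((u , ts) ∷ r) b B →
    length ((u , ts) ∷ r) < k → length (vertices ((u , ts) ∷ r)) < n →
    b ⊆ b′ → BoardBelow b′ (suc B) → EdgeCol b′ red B u →
    Config N ((B , []) ∷ (u , ts) ∷ r) b′ (suc B)
  push {u = u} {r = r} I short V<n b⊆b′ board-below e = record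
    { forest = Forest-grow forest refl (tt ∷ BluePaths-mono b⊆b′ (Forest.paths-blue forest)) board-below
    ; red-heads = e , ConsecCol-mono b⊆b′ (u ∷ heads r) red-heads
    ; few-paths = short
    ; full⇒top-single = λ _ → refl
    ; few-vertices = V<n
    ; budget = Budget-grow budget }
    where open Config I

  extendSole : ∀ {N u ts b b′ B} → Config (suc N) ((u , ts) ∷ []) b B →
    length (vertices ((u , ts) ∷ [])) < n →
    b ⊆ b′ → BoardBelow b′ (suc B) → EdgeCol b′ blue B u →
    Config N ((B , u ∷ ts) ∷ []) b′ (suc B)
  extendSole {u = u} {ts} I V<n b⊆b′ board-below e = record
    { forest = Forest-grow forest refl
        ((e , ConsecCol-mono b⊆b′ (u ∷ ts) (All.head (Forest.paths-blue forest))) ∷ []) board-below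
    ; red-heads = tt
    ; few-paths = ≤-trans (s≤s z≤n) 3≤k
    ; full⇒top-single = λ full → ⊥-elim (1≢k full)
    ; few-vertices = V<n
    ; budget = Budget-weaken (n≤1+n 1) (Budget-grow budget) }
    where open Config I

  extendTop : ∀ {N u ts p r b b′ B} → Config (suc N) ((u , ts) ∷ p ∷ r) b B →
    length ((u , ts) ∷ p ∷ r) < k → length (vertices ((u , ts) ∷ p ∷ r)) < n →
    b ⊆ b′ → BoardBelow b′ (suc B) → EdgeCol b′ blue B u →
    Detached N (B , u ∷ ts) (p ∷ r) b′ (suc B)
  extendTop {u = u} {ts} {p} {r} I short V<n b⊆b′ board-below e = record
    { forest = Forest-grow forest refl (prolonged (Forest.paths-blue forest)) board-below
    ; red-heads = ConsecCol-mono b⊆b′ (heads (p ∷ r)) (proj₂ red-heads)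
    ; few-paths = short
    ; few-vertices = V<n
    ; budget = Budget-grow budget }
    where
    open Config I
    prolonged : All (BluePath _) ((u , ts) ∷ p ∷ r) → All (BluePath _) ((_ , u ∷ ts) ∷ p ∷ r)
    prolonged (blue-top ∷ blue-rest) =
      (e , ConsecCol-mono b⊆b′ (u ∷ ts) blue-top) ∷ BluePaths-mono b⊆b′ blue-rest

  redCycle : ∀ {N u mid h t b b′ B} → Config N ((u , []) ∷ mid ++ [ (h , t) ]) b B →
    length ((u , []) ∷ mid ++ [ (h , t) ]) ≡ k → b ⊆ b′ → EdgeCol b′ red u h → RedCycle k b′
  redCycle {u = u} {mid} {h} {t} I full b⊆b′ e =
    u , heads mid ++ [ h ] , cycle-length , subst Unique heads≡ (proj₁ (Forest-heads forest)) ,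
    ConsecCol-∷ʳ (u ∷ heads mid)
      (ConsecCol-mono b⊆b′ _ (subst (ConsecCol _ red) heads≡ red-heads)) (EdgeCol-sym e)
    where
    open Config I
    heads≡ : heads ((u , []) ∷ mid ++ [ (h , t) ]) ≡ u ∷ heads mid ++ [ h ]
    heads≡ = heads-∷ʳ ((u , []) ∷ mid) (h , t)
    cycle-length : length (u ∷ heads mid ++ [ h ]) ≡ k
    cycle-length = trans (cong length (sym heads≡))
      (trans (length-map proj₁ ((u , []) ∷ mid ++ [ (h , t) ])) full)

  closeBlue : ∀ {N u mid h t b b′ B} → Config (suc N) ((u , []) ∷ mid ++ [ (h , t) ]) b B →
    length ((u , []) ∷ mid ++ [ (h , t) ]) ≡ k → b ⊆ b′ → BoardBelow b′ B → EdgeCol b′ blue u h →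
    Config N ((u , h ∷ t) ∷ mid) b′ B
  closeBlue {N} {u} {mid} {h} {t} I full b⊆b′ board-below e = record
    { forest = Forest-close forest b⊆b′ board-below e
    ; red-heads = ConsecCol-mono b⊆b′ (u ∷ heads mid) (ConsecCol-++⁻ˡ (u ∷ heads mid)
        (subst (ConsecCol _ red) (heads-∷ʳ ((u , []) ∷ mid) (h , t)) red-heads))
    ; few-paths = subst (suc (length mid) ≤_) (sym k≡) (n≤1+n _)
    ; full⇒top-single = λ full′ → ⊥-elim (<-irrefl (trans full′ k≡) ≤-refl)
    ; few-vertices = subst (_≤ n) V≡ few-vertices
    ; budget = subst (Budget n N _) V≡ (Budget-spend (subst (λ L → Budget n (suc N) L V) L≡ budget)) }
    where
    open Config I
    V = length (vertices ((u , []) ∷ mid ++ [ (h , t) ]))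
    L≡ : length ((u , []) ∷ mid ++ [ (h , t) ]) ≡ suc (suc (length mid))
    L≡ = cong suc (trans (length-++ mid) (+-comm (length mid) 1))
    k≡ : k ≡ suc (suc (length mid))
    k≡ = trans (sym full) L≡
    V≡ : V ≡ length (vertices ((u , h ∷ t) ∷ mid))
    V≡ = sym (↭-length (closing-↭ u mid h t))

  reattachRed : ∀ {N X p r b b′ B} → Detached (suc N) X (p ∷ r) b B →
    b ⊆ b′ → BoardBelow b′ B → EdgeCol b′ red (proj₁ X) (proj₁ p) → Config N (X ∷ p ∷ r) b′ B
  reattachRed {p = p} {r} I b⊆b′ board-below e = record
    { forest = Forest-reshape forest ↭-refl (BluePaths-mono b⊆b′ (Forest.paths-blue forest)) board-below
    ; red-heads = e , ConsecCol-mono b⊆b′ (heads (p ∷ r)) red-heads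
    ; few-paths = ≤-trans (n≤1+n _) few-paths
    ; full⇒top-single = λ full → ⊥-elim (<-irrefl full few-paths)
    ; few-vertices = few-vertices
    ; budget = Budget-spend budget }
    where open Detached I

  joinSole : ∀ {N X p b b′ B} → Detached (suc N) X (p ∷ []) b B →
    b ⊆ b′ → BoardBelow b′ B → EdgeCol b′ blue (proj₁ X) (proj₁ p) →
    Config N (joinAtHeads X p ∷ []) b′ B
  joinSole {N} {X} {p} I b⊆b′ board-below e = record
    { forest = Forest-join forest b⊆b′ board-below e
    ; red-heads = tt
    ; few-paths = ≤-trans (s≤s z≤n) 3≤k
    ; full⇒top-single = λ full → ⊥-elim (1≢k full)
    ; few-vertices = subst (_≤ n) V≡ few-vertices
    ; budget = subst (Budget n N 1) V≡ (Budget-weaken (n≤1+n 1) (Budget-spend budget)) }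
    where
    open Detached I
    V≡ = sym (↭-length (joining-↭ X p []))

  joinInto : ∀ {N X p q r b b′ B} → Detached (suc N) X (p ∷ q ∷ r) b B →
    b ⊆ b′ → BoardBelow b′ B → EdgeCol b′ blue (proj₁ X) (proj₁ p) →
    Detached N (joinAtHeads X p) (q ∷ r) b′ B
  joinInto {N} {X} {p} {q} {r} I b⊆b′ board-below e = record
    { forest = Forest-join forest b⊆b′ board-below e
    ; red-heads = ConsecCol-mono b⊆b′ (heads (q ∷ r)) (proj₂ red-heads)
    ; few-paths = ≤-trans (n≤1+n _) few-paths
    ; few-vertices = subst (_≤ n) V≡ few-vertices
    ; budget = subst (Budget n N _) V≡ (Budget-spend budget) }
    where
    open Detached I
    V≡ = sym (↭-length (joining-↭ X p (q ∷ r)))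

  mutual
    fromConfig : ∀ N p r {b B} → Config N (p ∷ r) b B → Wins k n N b
    fromConfig N p r I with length (p ∷ r) + (n ∸ length (vertices (p ∷ r))) ≤? k
    ... | yes fits = done (inj₂ (blueLineForest forest few-vertices fits))
      where open Config I
    ... | no ¬fits = playConfig N p r I (notAllCovered ¬fits (Config.few-paths I))

    playConfig : ∀ N p r {b B} → Config N (p ∷ r) b B → length (vertices (p ∷ r)) < n →
      Wins k n N b
    playConfig zero p r I V<n = ⊥-elim (<⇒≱ V<n (Budget-exhausted (Config.budget I)))
    playConfig (suc N) (u , ts) r I V<n with length ((u , ts) ∷ r) ≟ k
    ... | yes full = closeCycle N u ts r I full (Config.full⇒top-single I full)
    ... | no ¬full = growTop N u ts r I (≤∧≢⇒< (Config.few-paths I) ¬full) V<n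

    closeCycle : ∀ N u ts r {b B} → Config (suc N) ((u , ts) ∷ r) b B →
      length ((u , ts) ∷ r) ≡ k → ts ≡ [] → Wins k n (suc N) b
    closeCycle N u ts r I full refl with initLast r
    ... | [] = ⊥-elim (1≢k full)
    ... | mid ∷ʳ′ (h , t) = closeAt N u mid h t I full

    closeAt : ∀ N u mid h t {b B} → Config (suc N) ((u , []) ∷ mid ++ [ (h , t) ]) b B →
      length ((u , []) ∷ mid ++ [ (h , t) ]) ≡ k → Wins k n (suc N) b
    closeAt N u mid h t I full = query u h (Forest.board-below forest) u<B h<B u≢h λ
      { red b⊆b′ _ e → done (inj₁ (redCycle I full b⊆b′ e))
      ; blue b⊆b′ board-below e → fromConfig N (u , h ∷ t) mid (closeBlue I full b⊆b′ board-below e) }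
      where
      open Config I
      heads≡ : heads ((u , []) ∷ mid ++ [ (h , t) ]) ≡ u ∷ heads mid ++ [ h ]
      heads≡ = heads-∷ʳ ((u , []) ∷ mid) (h , t)
      distinct-heads = subst Unique heads≡ (proj₁ (Forest-heads forest))
      heads-below = subst (All _) heads≡ (proj₂ (Forest-heads forest))
      u<B = All.head heads-below
      h<B = All.head (Allₚ.++⁻ʳ (heads mid) (All.tail heads-below))
      u≢h = All.head (Allₚ.++⁻ʳ (heads mid) (AllPairs.head distinct-heads))

    growTop : ∀ N u ts r {b B} → Config (suc N) ((u , ts) ∷ r) b B →
      length ((u , ts) ∷ r) < k → length (vertices ((u , ts) ∷ r)) < n → Wins k n (suc N) b
    growTop N u ts r {B = B} I short V<n =
      query B u (BoardBelow-suc (Forest.board-below forest)) ≤-refl (m<n⇒m<1+n u<B) (>⇒≢ u<B) λ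
        { red b⊆b′ board-below e →
            fromConfig N (B , []) ((u , ts) ∷ r) (push I short V<n b⊆b′ board-below e)
        ; blue b⊆b′ board-below e → prolongTop N u ts r I short V<n b⊆b′ board-below e }
      where
      open Config I
      u<B = All.head (Forest.vertices-below forest)

    prolongTop : ∀ N u ts r {b b′ B} → Config (suc N) ((u , ts) ∷ r) b B →
      length ((u , ts) ∷ r) < k → length (vertices ((u , ts) ∷ r)) < n →
      b ⊆ b′ → BoardBelow b′ (suc B) → EdgeCol b′ blue B u → Wins k n N b′
    prolongTop N u ts [] {B = B} I short V<n b⊆b′ board-below e =
      fromConfig N (B , u ∷ ts) [] (extendSole I V<n b⊆b′ board-below e)
    prolongTop N u ts (p ∷ r) {B = B} I short V<n b⊆b′ board-below e =
      fromDetached N (B , u ∷ ts) p r (extendTop I short V<n b⊆b′ board-below e)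

    fromDetached : ∀ N X p r {b B} → Detached N X (p ∷ r) b B → Wins k n N b
    fromDetached N X p r I with length (X ∷ p ∷ r) + (n ∸ length (vertices (X ∷ p ∷ r))) ≤? k
    ... | yes fits = done (inj₂ (blueLineForest forest few-vertices fits))
      where open Detached I
    ... | no ¬fits =
      reattach N X p r I (notAllCovered ¬fits (≤-trans (n≤1+n _) (Detached.few-paths I)))

    reattach : ∀ N X p r {b B} → Detached N X (p ∷ r) b B → length (vertices (X ∷ p ∷ r)) < n →
      Wins k n N b
    reattach zero X p r I V<n = ⊥-elim (<⇒≱ V<n (Budget-exhausted (Detached.budget I)))
    reattach (suc N) X p r I V<n with Forest-heads (Detached.forest I)
    ... | (x≢ ∷ _) , x<B ∷ p<B ∷ _ =
      query (proj₁ X) (proj₁ p) (Forest.board-below (Detached.forest I)) x<B p<B (All.head x≢) λ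
        { red b⊆b′ board-below e → fromConfig N X (p ∷ r) (reattachRed I b⊆b′ board-below e)
        ; blue b⊆b′ board-below e → join N X p r I b⊆b′ board-below e }

    join : ∀ N X p r {b b′ B} → Detached (suc N) X (p ∷ r) b B →
      b ⊆ b′ → BoardBelow b′ B → EdgeCol b′ blue (proj₁ X) (proj₁ p) → Wins k n N b′
    join N X p [] I b⊆b′ board-below e =
      fromConfig N (joinAtHeads X p) [] (joinSole I b⊆b′ board-below e)
    join N X p (q ∷ r) I b⊆b′ board-below e =
      fromDetached N (joinAtHeads X p) q r (joinInto I b⊆b′ board-below e)

lemma6 : (m n k : ℕ) → 1 ≤ m → m ≤ n → 3 ≤ k →
    (vs : List ℕ) → length vs ≡ m → Unique vs →
    Wins k n (2 * n ∸ 2 * m) (bluePathBoard vs)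
lemma6 .0 _ _ () _ _ [] refl _
lemma6 _ n k 1≤m m≤n 3≤k (v ∷ vs) refl distinct =
  fromConfig _ (v , vs) [] (initialConfig v vs m≤n distinct)
  where open Strategy k n 3≤k
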